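{- Let $G=(V,E)$ be an undirected graph, $M\subseteq E$ a matching, and $G_M=(V',E_M)$ the directed graph defined below. Let $P=s,[v_1,B],[v_2,A],\ldots,[v_l,Z]$ be a shortest strongly simple path from $s$ to $[v_l,Z]$ in $G_M$, so that $\mathrm{level}([v_l,Z])=l$ (here the $i$-th node of $P$ after $s$ is $[v_i,B]$ for odd $i$ and $[v_i,A]$ for even $i$). Let $[v_j,X]$ be a node of $P$ (its $j$-th node after $s$) with $\mathrm{level}([v_j,\overline{X}])\geq l$. Then $\mathrm{level}([v_j,X])=j$, and $\mathrm{level}([v_i,Y])<\mathrm{level}([v_j,X])$ for every node $[v_i,Y]$ of $P$ with $i<j$.
   Context: A matching $M\subseteq E$ is a set of edges no two of which share a node; a node is $M$-free if it is incident to no edge of $M$, and $V_M$ denotes the set of $M$-free nodes. The directed graph $G_M=(V',E_M)$ is defined by $V'=\{[v,A],[v,B]\mid v\in V\}\cup\{s,t\}$ with $s,t$ two new distinct nodes, and $E_M=\{([v,A],[w,B]),([w,A],[v,B])\mid (v,w)\in M\}\cup\{([x,B],[y,A]),([y,B],[x,A])\mid (x,y)\in E\setminus M\}\cup\{(s,[v,B]),([v,A],t)\mid v\in V_M\}$. A path in $G_M$ is strongly simple if it is simple (no repeated node) and for no $v\in V$ does it contain both $[v,A]$ and $[v,B]$. For $X\in\{A,B\}$, $\overline{A}=B$ and $\overline{B}=A$. The level of a node $[v,X]\in V'$ is the length (number of edges) of a shortest strongly simple path from $s$ to $[v,X]$ in $G_M$ (taken to be $\infty$ if no such path exists). -}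

module Defs where

open import Data.Nat using (ℕ; _<_; _≤_)
open import Data.Fin using (Fin)
open import Data.List using (List; []; _∷_; length; last)
open import Data.Maybe using (just)
open import Data.Product using (_×_; Σ; ∃)
open import Data.Empty using (⊥)
open import Relation.Nullary using (¬_)
open import Relation.Binary.PropositionalEquality using (_≡_)
open import Data.List.Relation.Unary.Linked using (Linked)
open import Data.List.Relation.Unary.Unique.Propositional using (Unique)
open import Data.List.Membership.Propositional using (_∈_)

record Graph (n : ℕ) : Set₁ where
  field
    Adj     : Fin n → Fin n → Set
    Adj-sym : ∀ {x y} → Adj x y → Adj y x

record Matching {n : ℕ} (G : Graph n) : Set₁ where
  open Graph G
  field
    M       : Fin n → Fin n → Set
    M⊆E     : ∀ {x y} → M x y → Adj x y
    M-sym   : ∀ {x y} → M x y → M y x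
    M-match : ∀ {x y z} → M x y → M x z → y ≡ z

Free : ∀ {n} {G : Graph n} → Matching G → Fin n → Set
Free Mt v = ∀ w → ¬ Matching.M Mt v w

data Side : Set where
  A B : Side

bar : Side → Side
bar A = B
bar B = A

data Node (n : ℕ) : Set where
  s t : Node n
  [_,_] : Fin n → Side → Node n

data Arc {n : ℕ} {G : Graph n} (Mt : Matching G) : Node n → Node n → Set where
  matched   : ∀ {v w} → Matching.M Mt v w → Arc Mt [ v , A ] [ w , B ]
  unmatched : ∀ {x y} → Graph.Adj G x y → ¬ Matching.M Mt x y →
              Arc Mt [ x , B ] [ y , A ]
  from-s    : ∀ {v} → Free Mt v → Arc Mt s [ v , B ]
  to-t      : ∀ {v} → Free Mt v → Arc Mt [ v , A ] t

-- A strongly simple path from s to x in G_M, given by the list ps of its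
-- nodes after s (so the path is s ∷ ps and its length is length ps).
record SSPath {n : ℕ} {G : Graph n} (Mt : Matching G) (x : Node n)
              (ps : List (Node n)) : Set where
  field
    arcs   : Linked (Arc Mt) (s ∷ ps)
    ends   : last (s ∷ ps) ≡ just x
    simple : Unique (s ∷ ps)
    strong : ∀ v → ¬ ([ v , A ] ∈ ps × [ v , B ] ∈ ps)

LevelIs : ∀ {n} {G : Graph n} → Matching G → Node n → ℕ → Set
LevelIs Mt x k =
  Σ (List _) (λ ps → SSPath Mt x ps × length ps ≡ k)
  × (∀ qs → SSPath Mt x qs → k ≤ length qs)

-- level(x) ≥ l  (true in particular when level(x) = ∞)
LevelGeq : ∀ {n} {G : Graph n} → Matching G → Node n → ℕ → Set
LevelGeq Mt x l = ∀ qs → SSPath Mt x qs → l ≤ length qs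

-- level(y) < level(x)  (with ∞ as top; false if level(y) = ∞)
LevelLt : ∀ {n} {G : Graph n} → Matching G → Node n → Node n → Set
LevelLt Mt y x =
  Σ (List _) (λ ps → SSPath Mt y ps
    × (∀ qs → SSPath Mt x qs → length ps < length qs))

module Submission where

-- Forget the sides: every node [v,X] of G_M lies over the vertex
-- v of G (s and t lie over no vertex), and [v,A], [v,B] are twins, as are s
-- and t.  A path from s is strongly simple exactly when the vertices under its
-- nodes are pairwise distinct ("clean" walks).  Clean walks can be cut at a
-- node, glued along disjoint vertex sets, and reversed (reversing the arcs and
-- passing to twins maps G_M to itself).
--
-- Let P = s, pre, x₀, suf be a shortest clean path to
-- b such that twin x₀ has no clean path shorter than P, and suppose a clean
-- path Q to x₀ had at most |pre| nodes after s.  Let x be the first node of Q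
-- lying over a vertex of x₀, suf.  Then x is x₀, its twin, a node y of suf or
-- the twin of such a y; continuing Q from x forwards along P to b, or
-- backwards along the twin of P to twin x₀ (the detour lemma), gives a clean
-- path shorter than P to b or to twin x₀ -- a contradiction.  Hence
-- level(x₀) = |pre| + 1, which is the first claim of lemma5; the second
-- follows since the prefix of P up to an earlier node is a shorter clean path.

open import Defs
open import Data.Nat using (ℕ; _<_; _≤_; suc; _+_; z≤n; s≤s)
open import Data.Nat.Properties
  using (≤-refl; ≤-trans; ≤-reflexive; <-≤-trans; ≰⇒>; <⇒≱; +-comm; +-monoʳ-≤; +-monoˡ-<;
         module ≤-Reasoning)
open import Data.Fin using (Fin; toℕ; zero; suc)
import Data.Fin.Properties as Fin
open import Data.Maybe using (Maybe; just; nothing)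
import Data.Maybe.Properties as Maybe
open import Data.List using (List; []; _∷_; _++_; length; lookup; last; map; reverse)
open import Data.List.Properties
  using (length-++; length-++-sucʳ; length-++-≤ˡ; length-++-≤ʳ; length-map; length-reverse;
         ++-assoc; map-++; map-∘; map-cong; reverse-++; reverse-map; unfold-reverse)
open import Data.Product using (Σ; ∃₂; _×_; _,_; proj₁; proj₂)
import Data.Product as Product
open import Data.Sum using (_⊎_; inj₁; inj₂; [_,_]′)
import Data.Sum as Sum
open import Data.Empty using (⊥-elim)
open import Relation.Nullary using (¬_)
open import Relation.Nullary.Decidable using (toSum)
open import Relation.Unary using (Pred; Decidable; ∁)
open import Relation.Binary.PropositionalEquality
  using (_≡_; _≢_; refl; sym; trans; cong; subst; setoid; module ≡-Reasoning)
open import Data.List.Relation.Unary.Linked using (Linked; [-]; _∷_)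
import Data.List.Relation.Unary.All as All
open import Data.List.Relation.Unary.All.Properties using (All¬⇒¬Any; ++⁻ˡ; ++⁻ʳ)
open import Data.List.Relation.Unary.AllPairs using (AllPairs; []; _∷_)
import Data.List.Relation.Unary.AllPairs.Properties as AllPairs
open import Data.List.Relation.Unary.Any using (Any; here; there)
open import Data.List.Relation.Unary.First using (FirstView; first)
import Data.List.Relation.Unary.First as First
open import Data.List.Relation.Unary.First.Properties using (toView)
open import Data.List.Relation.Unary.Unique.Propositional using (Unique)
import Data.List.Relation.Unary.Unique.Propositional.Properties as Unique
open import Data.List.Relation.Binary.Disjoint.Propositional using (Disjoint)
open import Data.List.Relation.Binary.Subset.Propositional using (_⊆_)
open import Data.List.Relation.Binary.Subset.Propositional.Properties
  using (⊆-trans; ⊆-reflexive-↭; xs⊆x∷xs; xs⊆xs++ys; xs⊆ys++xs)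
  renaming (map⁺ to ⊆-map⁺)
open import Data.List.Relation.Binary.Permutation.Propositional using (↭-sym; ↭⇒↭ₛ)
open import Data.List.Relation.Binary.Permutation.Propositional.Properties using (↭-reverse)
import Data.List.Relation.Binary.Permutation.Setoid.Properties as Permutation
open import Data.List.Membership.Propositional using (_∈_; _∉_; lose)
open import Data.List.Membership.Propositional.Properties using (∈-map⁺; ∈-map⁻; ∈-∃++)

module _ {a} {A : Set a} where

  unique-++⁻ : ∀ (xs : List A) {ys} → Unique (xs ++ ys) →
               Unique xs × Unique ys × Disjoint xs ys
  unique-++⁻ []       u       = [] , u , λ ()
  unique-++⁻ (x ∷ xs) (h ∷ u) with unique-++⁻ xs u
  ... | uxs , uys , disj = ++⁻ˡ xs h ∷ uxs , uys , apart
    where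
      apart : Disjoint (x ∷ xs) _
      apart (here refl  , y∈ys) = All.lookup (++⁻ʳ xs h) y∈ys refl
      apart (there x∈xs , y∈ys) = disj (x∈xs , y∈ys)

  unique-reverse : ∀ {xs : List A} → Unique xs → Unique (reverse xs)
  unique-reverse {xs} =
    Permutation.Unique-resp-↭ (setoid A) (↭⇒↭ₛ (↭-sym (↭-reverse xs)))

  unique-map-injective : ∀ {b} {B : Set b} (f : A → B) {xs x y} →
                         Unique (map f xs) → x ∈ xs → y ∈ xs → f x ≡ f y → x ≡ y
  unique-map-injective f {_ ∷ _} _       (here refl)  (here refl)  _ = refl
  unique-map-injective f {_ ∷ _} (h ∷ _) (here refl)  (there y∈xs) e =
    ⊥-elim (All.lookup h (∈-map⁺ f y∈xs) e)
  unique-map-injective f {_ ∷ _} (h ∷ _) (there x∈xs) (here refl)  e =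
    ⊥-elim (All.lookup h (∈-map⁺ f x∈xs) (sym e))
  unique-map-injective f {_ ∷ _} (_ ∷ u) (there x∈xs) (there y∈xs) e =
    unique-map-injective f u x∈xs y∈xs e

  disjoint-⊆ʳ : ∀ {xs ys zs : List A} → Disjoint xs ys → zs ⊆ ys → Disjoint xs zs
  disjoint-⊆ʳ disj zs⊆ys (v∈xs , v∈zs) = disj (v∈xs , zs⊆ys v∈zs)

  first-view : ∀ {q} {Q : Pred A q} → Decidable Q → ∀ {xs} → Any Q xs →
               FirstView (∁ Q) Q xs
  first-view Q? {xs} any with first (λ x → Sum.swap (toSum (Q? x))) xs
  ... | inj₁ found = toView found
  ... | inj₂ none  = ⊥-elim (All¬⇒¬Any none any)

  split-at : ∀ (xs : List A) (k : Fin (length xs)) →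
             ∃₂ λ pre suf → xs ≡ pre ++ lookup xs k ∷ suf × length pre ≡ toℕ k
  split-at (x ∷ xs) zero    = [] , xs , refl , refl
  split-at (x ∷ xs) (suc k) with split-at xs k
  ... | pre , suf , xs≡ , len = x ∷ pre , suf , cong (x ∷_) xs≡ , cong suc len

  length-prefix : ∀ (xs : List A) y ys → suc (length xs) ≤ length (xs ++ y ∷ ys)
  length-prefix xs y ys =
    ≤-trans (s≤s (length-++-≤ˡ xs)) (≤-reflexive (sym (length-++-sucʳ xs y ys)))

  length-extend : ∀ (xs : List A) {ys k} → length ys ≤ k → length (xs ++ ys) ≤ length xs + k
  length-extend xs ys≤k = ≤-trans (≤-reflexive (length-++ xs)) (+-monoʳ-≤ (length xs) ys≤k)

module Paths {n : ℕ} {G : Graph n} (Mt : Matching G) where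

  open import Data.List.Membership.DecPropositional (Maybe.≡-dec (Fin._≟_ {n})) using (_∈?_)

  Nd : Set
  Nd = Node n

  twin : Nd → Nd
  twin s         = t
  twin t         = s
  twin [ v , X ] = [ v , bar X ]

  vertex : Nd → Maybe (Fin n)
  vertex s         = nothing
  vertex t         = nothing
  vertex [ v , _ ] = just v

  trace : List Nd → List (Maybe (Fin n))
  trace = map vertex

  vertex-twin : ∀ x → vertex (twin x) ≡ vertex x
  vertex-twin s         = refl
  vertex-twin t         = refl
  vertex-twin [ v , X ] = refl

  same-vertex : ∀ {x y} → vertex x ≡ vertex y → x ≡ y ⊎ x ≡ twin y
  same-vertex {s}         {s}         _    = inj₁ refl
  same-vertex {s}         {t}         _    = inj₂ refl
  same-vertex {t}         {s}         _    = inj₂ refl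
  same-vertex {t}         {t}         _    = inj₁ refl
  same-vertex {s}         {[ _ , _ ]} ()
  same-vertex {t}         {[ _ , _ ]} ()
  same-vertex {[ _ , _ ]} {s}         ()
  same-vertex {[ _ , _ ]} {t}         ()
  same-vertex {[ v , A ]} {[ v , A ]} refl = inj₁ refl
  same-vertex {[ v , A ]} {[ v , B ]} refl = inj₂ refl
  same-vertex {[ v , B ]} {[ v , A ]} refl = inj₂ refl
  same-vertex {[ v , B ]} {[ v , B ]} refl = inj₁ refl

  -- G_M is isomorphic to its reverse via twins (M and E are symmetric).
  arc-back : ∀ {x y} → Arc Mt x y → Arc Mt (twin y) (twin x)
  arc-back (matched m)       = matched (Matching.M-sym Mt m)
  arc-back (unmatched e e∉M) = unmatched (Graph.Adj-sym G e) (λ m → e∉M (Matching.M-sym Mt m))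
  arc-back (from-s free)     = to-t free
  arc-back (to-t free)       = from-s free

  -- Walk x l y: a walk from x whose nodes after x are l, ending in y.
  data Walk : Nd → List Nd → Nd → Set where
    []  : ∀ {x} → Walk x [] x
    _∷_ : ∀ {x y l z} → Arc Mt x y → Walk y l z → Walk x (y ∷ l) z

  walk-++ : ∀ {x l y m z} → Walk x l y → Walk y m z → Walk x (l ++ m) z
  walk-++ []      w = w
  walk-++ (e ∷ v) w = e ∷ walk-++ v w

  walk-split : ∀ l {x y r z} → Walk x (l ++ y ∷ r) z → Walk x (l ++ y ∷ []) y × Walk y r z
  walk-split []      (e ∷ w) = e ∷ [] , w
  walk-split (_ ∷ l) (e ∷ w) = Product.map₁ (e ∷_) (walk-split l w)

  walk-end : ∀ {x l y} → Walk x l y → y ≡ x ⊎ y ∈ l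
  walk-end []      = inj₁ refl
  walk-end (_ ∷ w) = inj₂ (Sum.[ (λ { refl → here refl }) , there ]′ (walk-end w))

  -- t has no outgoing arc, so it is not an inner node of a walk to [v,X].
  walk-avoids-t : ∀ {x l v X} → Walk x l [ v , X ] → t ∉ l
  walk-avoids-t (_ ∷ (() ∷ _)) (here refl)
  walk-avoids-t (_ ∷ w)        (there t∈l) = walk-avoids-t w t∈l

  back : List Nd → List Nd
  back xs = reverse (map twin xs)

  back-snoc : ∀ xs y → back (xs ++ y ∷ []) ≡ twin y ∷ back xs
  back-snoc xs y = begin
    reverse (map twin (xs ++ y ∷ []))      ≡⟨ cong reverse (map-++ twin xs (y ∷ [])) ⟩
    reverse (map twin xs ++ twin y ∷ [])   ≡⟨ reverse-++ (map twin xs) (twin y ∷ []) ⟩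
    twin y ∷ reverse (map twin xs)        ∎
    where open ≡-Reasoning

  trace-back : ∀ xs → trace (back xs) ≡ reverse (trace xs)
  trace-back xs = begin
    map vertex (reverse (map twin xs))    ≡⟨ reverse-map vertex (map twin xs) ⟩
    reverse (map vertex (map twin xs))    ≡⟨ cong reverse (map-∘ xs) ⟨
    reverse (map (λ x → vertex (twin x)) xs) ≡⟨ cong reverse (map-cong vertex-twin xs) ⟩
    reverse (map vertex xs)               ∎
    where open ≡-Reasoning

  trace-back-⊆ : ∀ xs → trace (back xs) ⊆ trace xs
  trace-back-⊆ xs rewrite trace-back xs = ⊆-reflexive-↭ (↭-reverse (trace xs))

  length-back : ∀ xs → length (back xs) ≡ length xs
  length-back xs = trans (length-reverse (map twin xs)) (length-map twin xs)

  walk-back : ∀ {x} l {y} → Walk x (l ++ y ∷ []) y → Walk (twin y) (back (x ∷ l)) (twin x)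
  walk-back         []      (e ∷ []) = arc-back e ∷ []
  walk-back {x} (z ∷ l) {y} (e ∷ w)  =
    subst (λ zs → Walk (twin y) zs (twin x)) (sym (unfold-reverse (twin x) (map twin (z ∷ l))))
      (walk-++ (walk-back l w) (arc-back e ∷ []))

  -- A clean walk visits pairwise distinct vertices of G (s, t count as one).
  record CleanWalk (x : Nd) (l : List Nd) (y : Nd) : Set where
    constructor clean
    field
      walk     : Walk x l y
      distinct : Unique (trace (x ∷ l))

  trace-unique-++⁻ : ∀ xs ys → Unique (trace (xs ++ ys)) →
                     Unique (trace xs) × Unique (trace ys) × Disjoint (trace xs) (trace ys)
  trace-unique-++⁻ xs ys u = unique-++⁻ (trace xs) (subst Unique (map-++ vertex xs ys) u)

  cw-split : ∀ l {x y r z} → CleanWalk x (l ++ y ∷ r) z →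
             CleanWalk x (l ++ y ∷ []) y × CleanWalk y r z
  cw-split l {x} {y} {r} (clean w u) =
    clean (proj₁ (walk-split l w)) (proj₁ (trace-unique-++⁻ (x ∷ l ++ y ∷ []) r u′)) ,
    clean (proj₂ (walk-split l w)) (proj₁ (proj₂ (trace-unique-++⁻ (x ∷ l) (y ∷ r) u)))
    where
      u′ : Unique (trace (x ∷ (l ++ y ∷ []) ++ r))
      u′ = subst (λ zs → Unique (trace (x ∷ zs))) (sym (++-assoc l (y ∷ []) r)) u

  cw-disjoint : ∀ l {x y r z} → CleanWalk x (l ++ y ∷ r) z →
                Disjoint (trace (x ∷ l)) (trace (y ∷ r))
  cw-disjoint l {x} {y} {r} (clean _ u) = proj₂ (proj₂ (trace-unique-++⁻ (x ∷ l) (y ∷ r) u))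

  cw-join : ∀ l {x y r z} → CleanWalk x (l ++ y ∷ []) y → CleanWalk y r z →
            Disjoint (trace (x ∷ l)) (trace r) → CleanWalk x (l ++ y ∷ r) z
  cw-join l {x} {y} {r} {z} P@(clean v u) (clean w u′) disj =
    clean (subst (λ zs → Walk x zs z) (++-assoc l (y ∷ []) r) (walk-++ v w))
          (subst Unique (sym (map-++ vertex (x ∷ l) (y ∷ r)))
             (Unique.++⁺ (proj₁ (trace-unique-++⁻ (x ∷ l) (y ∷ []) u)) u′ apart))
    where
      apart : Disjoint (trace (x ∷ l)) (trace (y ∷ r))
      apart (v∈ , here e)  = cw-disjoint l P (v∈ , here e)
      apart (v∈ , there m) = disj (v∈ , m)

  cw-back : ∀ l {x y} → CleanWalk x (l ++ y ∷ []) y → CleanWalk (twin y) (back (x ∷ l)) (twin x)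
  cw-back l {x} {y} (clean w u) =
    clean (walk-back l w)
          (subst (λ zs → Unique (trace zs)) (back-snoc (x ∷ l) y)
             (subst Unique (sym (trace-back (x ∷ l ++ y ∷ []))) (unique-reverse u)))

  Route : List Nd → Nd → Set
  Route = CleanWalk s

  AtLeast : ℕ → Nd → Set
  AtLeast k c = ∀ {l} → Route l c → k ≤ length l

  Within : ℕ → Nd → Set
  Within k c = Σ (List Nd) λ l → Route l c × length l ≤ k

  walk⇒linked : ∀ {x l y} → Walk x l y → Linked (Arc Mt) (x ∷ l) × last (x ∷ l) ≡ just y
  walk⇒linked []      = [-] , refl
  walk⇒linked (e ∷ w) = Product.map₁ (e ∷_) (walk⇒linked w)

  linked⇒walk : ∀ {x} l {y} → Linked (Arc Mt) (x ∷ l) → last (x ∷ l) ≡ just y → Walk x l y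
  linked⇒walk []      _        refl = []
  linked⇒walk (_ ∷ l) (e ∷ es) end  = e ∷ linked⇒walk l es end

  -- Routes are strongly simple paths: distinct vertices give distinct nodes
  -- and exclude [v,A], [v,B] on the same path.
  route⇒ss : ∀ {l y} → Route l y → SSPath Mt y l
  route⇒ss {l} (clean w u@(_ ∷ u-tail)) = record
    { arcs   = proj₁ (walk⇒linked w)
    ; ends   = proj₂ (walk⇒linked w)
    ; simple = Unique.map⁻ u
    ; strong = λ v (A∈ , B∈) → sides-differ (unique-map-injective vertex u-tail A∈ B∈ refl)
    }
    where
      sides-differ : ∀ {v} → [ v , A ] ≢ [ v , B ]
      sides-differ ()

  distinct-vertices : ∀ {l} → Unique l → (∀ {x y} → x ∈ l → y ∈ l → x ≢ twin y) →
                      AllPairs (λ x y → vertex x ≢ vertex y) l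
  distinct-vertices []      _        = []
  distinct-vertices (h ∷ u) no-twins =
    All.tabulate (λ y∈ e → [ All.lookup h y∈ , no-twins (here refl) (there y∈) ]′ (same-vertex e))
    ∷ distinct-vertices u (λ x∈ y∈ → no-twins (there x∈) (there y∈))

  -- Conversely, a strongly simple path to [v,X] has distinct vertices: it
  -- repeats no node, contains no [v,A], [v,B] pair, and avoids t.
  ss⇒route : ∀ {l v X} → SSPath Mt [ v , X ] l → Route l [ v , X ]
  ss⇒route {l} {v} {X} P = clean w (AllPairs.map⁺ (distinct-vertices (SSPath.simple P) no-twins))
    where
      w : Walk s l [ v , X ]
      w = linked⇒walk l (SSPath.arcs P) (SSPath.ends P)
      t∉ : t ∉ s ∷ l
      t∉ (there t∈l) = walk-avoids-t w t∈l
      off-s : ∀ {v X} → [ v , X ] ∈ s ∷ l → [ v , X ] ∈ l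
      off-s (there m) = m
      no-twins : ∀ {x y} → x ∈ s ∷ l → y ∈ s ∷ l → x ≢ twin y
      no-twins {y = s}         x∈ _  refl = t∉ x∈
      no-twins {y = t}         _  y∈ _    = t∉ y∈
      no-twins {y = [ v , A ]} x∈ y∈ refl = SSPath.strong P v (off-s y∈ , off-s x∈)
      no-twins {y = [ v , B ]} x∈ y∈ refl = SSPath.strong P v (off-s x∈ , off-s y∈)

  continue : ∀ q {x r z k} → Route (q ++ x ∷ []) x → CleanWalk x r z →
             Disjoint (trace (s ∷ q)) (trace r) → length (x ∷ r) ≤ k → Within (length q + k) z
  continue q Q W disj bound = _ , cw-join q Q W disj , length-extend q bound

  route-end : ∀ {l x} → Route l x → x ≢ s → x ∈ l
  route-end Q x≢s = Sum.[ (λ x≡s → ⊥-elim (x≢s x≡s)) , (λ x∈l → x∈l) ]′ (walk-end (CleanWalk.walk Q))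

  tail-avoids-s : ∀ pre {x suf b} → Route (pre ++ x ∷ suf) b → vertex s ∉ trace (x ∷ suf)
  tail-avoids-s pre P v∈ = cw-disjoint pre P (here refl , v∈)

  detour : ∀ q {x x₀} suf {b} → Route (q ++ x ∷ []) x → CleanWalk x₀ suf b →
           Disjoint (trace (s ∷ q)) (trace (x₀ ∷ suf)) → vertex x ∈ trace (x₀ ∷ suf) →
           Within (length q + length (x₀ ∷ suf)) b ⊎ Within (length q + length (x₀ ∷ suf)) (twin x₀)
  detour q suf Q tail disj (here e) with same-vertex e
  ... | inj₁ refl = inj₁ (continue q Q tail (disjoint-⊆ʳ disj (xs⊆x∷xs _ _)) ≤-refl)
  ... | inj₂ refl = inj₂ (_ , Q , length-extend q (s≤s z≤n))
  detour q {x₀ = x₀} suf Q tail disj (there m) with ∈-map⁻ vertex m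
  ... | y , y∈suf , e with ∈-∃++ y∈suf
  ... | s₁ , s₂ , refl with cw-split s₁ tail | same-vertex e
  ... | _      , from-y | inj₁ refl =
    inj₁ (continue q Q from-y (disjoint-⊆ʳ disj (⊆-map⁺ vertex s₂⊆)) (length-++-≤ʳ (y ∷ s₂) {x₀ ∷ s₁}))
    where
      s₂⊆ : s₂ ⊆ x₀ ∷ s₁ ++ y ∷ s₂
      s₂⊆ = ⊆-trans (xs⊆x∷xs s₂ y) (xs⊆ys++xs (y ∷ s₂) (x₀ ∷ s₁))
  ... | upto-y , _      | inj₂ refl =
    inj₂ (continue q Q (cw-back s₁ upto-y) (disjoint-⊆ʳ disj back⊆) bound)
    where
      back⊆ : trace (back (x₀ ∷ s₁)) ⊆ trace (x₀ ∷ s₁ ++ y ∷ s₂)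
      back⊆ = ⊆-trans (trace-back-⊆ (x₀ ∷ s₁)) (⊆-map⁺ vertex (xs⊆xs++ys (x₀ ∷ s₁) (y ∷ s₂)))
      bound : length (twin y ∷ back (x₀ ∷ s₁)) ≤ length (x₀ ∷ s₁ ++ y ∷ s₂)
      bound = s≤s (≤-trans (≤-reflexive (length-back (x₀ ∷ s₁))) (length-prefix s₁ y s₂))

  no-shortcut : ∀ pre {x₀} suf {b l} → Route (pre ++ x₀ ∷ suf) b →
                AtLeast (length (pre ++ x₀ ∷ suf)) b → AtLeast (length (pre ++ x₀ ∷ suf)) (twin x₀) →
                Route l x₀ → ¬ (length l ≤ length pre)
  no-shortcut pre {x₀} suf P b-far twin-far Q l≤pre
    with first-view (λ x → vertex x ∈? trace (x₀ ∷ suf))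
                    (lose (route-end Q (λ { refl → tail-avoids-s pre P (here refl) })) (here refl))
  ... | First._++_∷_ {q} {x} avoid x∈T rest =
    [ too-short b-far , too-short twin-far ]′
      (detour q suf (proj₁ (cw-split q Q)) (proj₂ (cw-split pre P)) disj x∈T)
    where
      K : ℕ
      K = length (x₀ ∷ suf)
      disj : Disjoint (trace (s ∷ q)) (trace (x₀ ∷ suf))
      disj (here refl  , v∈T) = tail-avoids-s pre P v∈T
      disj (there v∈q , v∈T) with ∈-map⁻ vertex v∈q
      ... | u , u∈q , refl = All.lookup avoid u∈q v∈T
      q<pre : length q < length pre
      q<pre = ≤-trans (length-prefix q x rest) l≤pre
      too-short : ∀ {c} → AtLeast (length (pre ++ x₀ ∷ suf)) c → ¬ Within (length q + K) c
      too-short far (l′ , R , l′≤) = <⇒≱ shorter (far R)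
        where
          open ≤-Reasoning
          shorter : length l′ < length (pre ++ x₀ ∷ suf)
          shorter = begin-strict
            length l′                 ≤⟨ l′≤ ⟩
            length q + K              <⟨ +-monoˡ-< K q<pre ⟩
            length pre + K            ≡⟨ length-++ pre ⟨
            length (pre ++ x₀ ∷ suf)  ∎

  -- Lower bound of lemma5: if x is the node at index k (the (k+1)-th node) of
  -- a shortest route to b and twin x has no route shorter than it, then every
  -- route to x has at least k + 1 nodes.
  level-at : ∀ {ps b x} (k : Fin (length ps)) → lookup ps k ≡ x → Route ps b →
             AtLeast (length ps) b → AtLeast (length ps) (twin x) → AtLeast (suc (toℕ k)) x
  level-at {ps} {b} k refl P b-far twin-far with split-at ps k
  ... | pre , suf , ps≡ , len =
    subst (λ m → AtLeast (suc m) _) len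
      (λ Q → ≰⇒> (no-shortcut pre suf (subst (λ l → Route l b) ps≡ P)
                     (subst (λ m → AtLeast m b) (cong length ps≡) b-far)
                     (subst (λ m → AtLeast m _) (cong length ps≡) twin-far) Q))

  prefix-at : ∀ {ps b} (k : Fin (length ps)) → Route ps b →
              Σ (List Nd) λ l → Route l (lookup ps k) × length l ≡ suc (toℕ k)
  prefix-at {ps} {b} k P with split-at ps k
  ... | pre , suf , ps≡ , len =
    pre ++ lookup ps k ∷ [] ,
    proj₁ (cw-split pre (subst (λ l → Route l b) ps≡ P)) ,
    trans (length-++ pre) (trans (+-comm (length pre) 1) (cong suc len))

lemma5 : ∀ {n} (G : Graph n) (Mt : Matching G) (vl : Fin n) (Z : Side)
         (ps : List (Node n)) →
         SSPath Mt [ vl , Z ] ps →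
         (∀ qs → SSPath Mt [ vl , Z ] qs → length ps ≤ length qs) →
         (k : Fin (length ps)) (vj : Fin n) (X : Side) →
         lookup ps k ≡ [ vj , X ] →
         LevelGeq Mt [ vj , bar X ] (length ps) →
         LevelIs Mt [ vj , X ] (suc (toℕ k))
         × (∀ (i : Fin (length ps)) → toℕ i < toℕ k →
            LevelLt Mt (lookup ps i) (lookup ps k))
lemma5 G Mt vl Z ps P shortest k vj X at-k far = level-k , earlier
  where
    open Paths Mt
    P′ : Route ps [ vl , Z ]
    P′ = ss⇒route P

    lower : ∀ qs → SSPath Mt [ vj , X ] qs → suc (toℕ k) ≤ length qs
    lower _ Q = level-at k at-k P′ (λ R → shortest _ (route⇒ss R)) (λ R → far _ (route⇒ss R))
                  (ss⇒route Q)

    level-k : LevelIs Mt [ vj , X ] (suc (toℕ k))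
    level-k with prefix-at k P′
    ... | l , R , len = (l , subst (λ x → SSPath Mt x l) at-k (route⇒ss R) , len) , lower

    earlier : ∀ i → toℕ i < toℕ k → LevelLt Mt (lookup ps i) (lookup ps k)
    earlier i i<k with prefix-at i P′
    ... | l , R , len = l , route⇒ss R , λ qs Q →
      subst (_< length qs) (sym len)
        (<-≤-trans (s≤s i<k) (lower qs (subst (λ x → SSPath Mt x qs) at-k Q)))
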